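{- Let $G$ be a finite simple graph that is the complement of a bipartite graph, with clique number $\omega=\omega(G)$. Then $\varphi(G)\leq \frac{4\omega}{3}$. Furthermore, for a positive integer $b$, $G$ admits a $b$-coloring with $b$ colors if and only if $G\in\mathcal{A}_b$.
   Context: A $b$-coloring of $G$ with $b$ colors is a proper coloring of $V(G)$ using exactly $b$ colors such that for every color $i$ there is a vertex of color $i$ having neighbors of all the other $b-1$ colors. The $b$-chromatic number $\varphi(G)$ is the largest $b$ for which such a coloring exists. $\omega(G)$ is the largest order of a complete subgraph. An antimatching between disjoint vertex sets $S,T$ of $G$ is a matching between $S$ and $T$ in the complement $\overline{G}$; it is perfect if it covers all of $S\cup T$ (so $|S|=|T|$ and each vertex of $S$ is paired with a distinct non-neighbor in $T$). The family $\mathcal{A}_b$ consists of all graphs $G$ that are complements of bipartite graphs for which there is a partition $V(G)=X\cup Y$ with $X$ and $Y$ each inducing a clique in $G$, together with partitions $X=A_1\cup B_1\cup C_1$ and $Y=A_2\cup B_2\cup C_2$ (parts possibly empty) such that: (1) every vertex of $A_1$ is adjacent to every vertex of $A_2\cup B_2$, and every vertex of $A_2$ is adjacent to every vertex of $C_1$; (2) $|B_1|=|B_2|$ and there is a perfect antimatching between $B_1$ and $B_2$; (3) $|C_1|=|C_2|$ and there is a perfect antimatching between $C_1$ and $C_2$; and $b=|A_1|+|A_2|+|B_1|+|C_1|=|X|+|A_2|$. -}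

module Defs where

open import Data.Nat using (ℕ; _+_; _*_; _≤_)
open import Data.Fin using (Fin)
open import Data.Fin.Base using (toℕ)
open import Data.Bool using (Bool; true; false; T)
open import Data.List using (List; length; filter; allFin)
open import Data.Product using (Σ; _×_; ∃; ∃-syntax; _,_)
open import Data.Sum using (_⊎_)
open import Relation.Nullary using (¬_)
open import Relation.Nullary.Decidable using (does)
open import Relation.Binary.PropositionalEquality using (_≡_; _≢_)
open import Function.Definitions using (Injective)
open import Function.Bundles using (_⇔_)
open import Relation.Unary using (Pred)

record Graph (n : ℕ) : Set where
  field
    adj     : Fin n → Fin n → Bool
    symm    : ∀ u v → adj u v ≡ adj v u
    irrefl  : ∀ v → adj v v ≡ false

open Graph public

Adj : ∀ {n} → Graph n → Fin n → Fin n → Set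
Adj G u v = adj G u v ≡ true

not′ : Bool → Bool
not′ true = false
not′ false = true

complement : ∀ {n} → Graph n → Graph n
complement {n} G = record { adj = λ u v → c u v ; symm = s ; irrefl = i }
  where
  open import Data.Fin.Properties using (_≟_)
  c : Fin n → Fin n → Bool
  c u v with does (u ≟ v)
  ... | true  = false
  ... | false = not′ (adj G u v)
  s : ∀ u v → c u v ≡ c v u
  s u v with u ≟ v | v ≟ u
  ... | Relation.Nullary.yes _ | Relation.Nullary.yes _ = Relation.Binary.PropositionalEquality.refl
  ... | Relation.Nullary.yes p | Relation.Nullary.no q = Data.Empty.⊥-elim (q (Relation.Binary.PropositionalEquality.sym p))
    where import Data.Empty
  ... | Relation.Nullary.no p | Relation.Nullary.yes q = Data.Empty.⊥-elim (p (Relation.Binary.PropositionalEquality.sym q))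
    where import Data.Empty
  ... | Relation.Nullary.no _ | Relation.Nullary.no _ =
        Relation.Binary.PropositionalEquality.cong not′ (symm G u v)
  i : ∀ v → c v v ≡ false
  i v with v ≟ v
  ... | Relation.Nullary.yes _ = Relation.Binary.PropositionalEquality.refl
  ... | Relation.Nullary.no q = Data.Empty.⊥-elim (q Relation.Binary.PropositionalEquality.refl)
    where import Data.Empty

IsBipartite : ∀ {n} → Graph n → Set
IsBipartite {n} G = Σ (Fin n → Fin 2) λ side → ∀ u v → Adj G u v → side u ≢ side v

IsCoBipartite : ∀ {n} → Graph n → Set
IsCoBipartite G = IsBipartite (complement G)

IsClique : ∀ {n k} → Graph n → (Fin k → Fin n) → Set
IsClique G f = Injective _≡_ _≡_ f × (∀ i j → i ≢ j → Adj G (f i) (f j))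

IsCliqueNumber : ∀ {n} → Graph n → ℕ → Set
IsCliqueNumber {n} G k =
  (Σ (Fin k → Fin n) λ f → IsClique G f) ×
  (∀ m (f : Fin m → Fin n) → IsClique G f → m ≤ k)

IsBColoring : ∀ {n} → Graph n → (b : ℕ) → (Fin n → Fin b) → Set
IsBColoring {n} G b c =
  (∀ u v → Adj G u v → c u ≢ c v) ×
  (∀ (i : Fin b) → ∃[ v ] c v ≡ i) ×
  (∀ (i : Fin b) → ∃[ v ] (c v ≡ i ×
       (∀ (j : Fin b) → j ≢ i → ∃[ w ] (Adj G v w × c w ≡ j))))

HasBColoring : ∀ {n} → Graph n → ℕ → Set
HasBColoring {n} G b = Σ (Fin n → Fin b) λ c → IsBColoring G b c

IsBChromaticNumber : ∀ {n} → Graph n → ℕ → Set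
IsBChromaticNumber G b = HasBColoring G b × (∀ b′ → HasBColoring G b′ → b′ ≤ b)

data Part : Set where
  A₁ B₁ C₁ A₂ B₂ C₂ : Part

inX : Part → Bool
inX A₁ = true
inX B₁ = true
inX C₁ = true
inX _  = false

isA₁ isB₁ isC₁ isA₂ isB₂ isC₂ : Part → Bool
isA₁ A₁ = true
isA₁ _  = false
isB₁ B₁ = true
isB₁ _  = false
isC₁ C₁ = true
isC₁ _  = false
isA₂ A₂ = true
isA₂ _  = false
isB₂ B₂ = true
isB₂ _  = false
isC₂ C₂ = true
isC₂ _  = false

count : ∀ {n} → (Fin n → Bool) → ℕ
count {n} p = length (filter (λ v → Data.Bool._≟_ (p v) true) (allFin n))
  where import Data.Bool

-- Perfect antimatching between vertex sets S and T (given as predicates):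
-- a matching in the complement of G covering S ∪ T, encoded as
-- k pairs (s i, t i) with s an injective enumeration of S, t an injective
-- enumeration of T, and s i, t i non-adjacent in G.
PerfectAntimatching : ∀ {n} → Graph n → (Fin n → Bool) → (Fin n → Bool) → Set
PerfectAntimatching {n} G S R =
  Σ ℕ λ k → Σ (Fin k → Fin n) λ s → Σ (Fin k → Fin n) λ t →
    Injective _≡_ _≡_ s × Injective _≡_ _≡_ t ×
    (∀ v → (T (S v) ⇔ (∃[ i ] s i ≡ v))) ×
    (∀ v → (T (R v) ⇔ (∃[ i ] t i ≡ v))) ×
    (∀ i → ¬ Adj G (s i) (t i))

InFamilyA : ∀ {n} → Graph n → ℕ → Set
InFamilyA {n} G b =
  IsCoBipartite G ×
  Σ (Fin n → Part) λ lab →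
    (∀ u v → u ≢ v → inX (lab u) ≡ inX (lab v) → Adj G u v) ×
    (∀ u v → lab u ≡ A₁ → (lab v ≡ A₂ ⊎ lab v ≡ B₂) → Adj G u v) ×
    (∀ u v → lab u ≡ A₂ → lab v ≡ C₁ → Adj G u v) ×
    -- (2), (3)  (perfect antimatchings force |B₁| = |B₂|, |C₁| = |C₂|)
    PerfectAntimatching G (λ v → isB₁ (lab v)) (λ v → isB₂ (lab v)) ×
    PerfectAntimatching G (λ v → isC₁ (lab v)) (λ v → isC₂ (lab v)) ×
    b ≡ count (λ v → isA₁ (lab v)) + count (λ v → isA₂ (lab v))
          + count (λ v → isB₁ (lab v)) + count (λ v → isC₁ (lab v))

{-# OPTIONS --safe #-}
module Submission where

-- In a b-colouring of a co-bipartite graph whose sides X and Y are cliques, every colour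
-- class has at most one vertex on each side; fix a b-vertex for every colour.  For each side
-- s, the vertices on s form a clique, and so do the b-vertices on s together with the
-- b-vertices of the colours missing from s (such a colour class is a single vertex, adjacent
-- to every other b-vertex).  These four cliques meet every colour exactly three times, so
-- 3b ≤ 4ω.  Recording for each vertex its side, whether its colour class also meets the other
-- side, and whether it is the b-vertex of its colour gives the partition of 𝒜_b: singleton
-- classes form A₁ ∪ A₂, two-vertex classes are antimatched pairs, split into B and C by the
-- side of their b-vertex, and the b-vertices are exactly A₁ ∪ A₂ ∪ B₂ ∪ C₁, so b counts
-- A₁, A₂, B₁ and C₁.  Conversely, colouring each vertex of A₁ ∪ A₂ alone and each
-- antimatched pair together is a b-colouring with b-vertices A₁ ∪ A₂ ∪ B₂ ∪ C₁.

open import Defs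
open import Data.Nat using (ℕ; zero; suc; _+_; _*_; _≤_; NonZero)
open import Data.Nat.Properties
  using (+-0-commutativeMonoid; ≤-antisym; +-assoc; *-comm; +-mono-≤; module ≤-Reasoning)
open import Data.Nat.Tactic.RingSolver using (solve-∀)
open import Data.Fin using (Fin; zero; suc)
open import Data.Fin.Patterns using (0F; 1F)
open import Data.Fin.Properties using (suc-injective; injective⇒≤; _≟_; any?; +↔⊎)
open import Data.Bool using (Bool; true; false; T; not; _∨_)
open import Data.Bool.Properties using (not-involutive) renaming (_≟_ to _≟ᵇ_)
open import Data.List using (length; filter; tabulate)
open import Data.Product using (_×_; ∃-syntax; _,_; proj₁; proj₂)
open import Data.Sum using (_⊎_; inj₁; inj₂)
open import Data.Unit using (tt)
open import Data.Empty using (⊥-elim)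
open import Relation.Nullary using (¬_; Dec; yes; no; does)
open import Relation.Nullary.Decidable using (_×-dec_; _⊎-dec_; ¬?; dec-true; dec-false)
open import Function using (_∘_)
open import Function.Definitions using (Injective)
open import Function.Bundles using (_⇔_; mk⇔; Equivalence; _↔_; Inverse)
open import Function.Construct.Composition using (_⇔-∘_; _↔-∘_)
open import Function.Construct.Identity using (↔-id)
open import Data.Sum.Function.Propositional using (_⊎-↔_)
open import Relation.Binary.PropositionalEquality
open import Algebra.Properties.CommutativeMonoid.Sum +-0-commutativeMonoid
  using (sum; ∑-distrib-+; sum-cong-≗)

open Equivalence using (to; from)

-- Counting and enumerating Boolean predicates on Fin n

indicator : Bool → ℕ
indicator true  = 1
indicator false = 0

count-tabulate : ∀ {m n} (p : Fin m → Bool) (g : Fin n → Fin m) →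
  length (filter (λ v → p v ≟ᵇ true) (tabulate g)) ≡ sum (indicator ∘ p ∘ g)
count-tabulate {n = zero}  p g = refl
count-tabulate {n = suc n} p g with p (g zero)
... | true  = cong suc (count-tabulate p (g ∘ suc))
... | false = count-tabulate p (g ∘ suc)

count-as-sum : ∀ {n} (p : Fin n → Bool) → count p ≡ sum (indicator ∘ p)
count-as-sum p = count-tabulate p (λ v → v)

sum-const : ∀ n k → sum {n} (λ _ → k) ≡ n * k
sum-const zero    k = refl
sum-const (suc n) k = cong (k +_) (sum-const n k)

four-times : ∀ w → w + w + w + w ≡ 4 * w
four-times = solve-∀

count-cover : ∀ {n} (p q r s : Fin n → Bool) (f : Fin n → ℕ) →
  (∀ v → indicator (p v) + indicator (q v) + indicator (r v) + indicator (s v) ≡ f v) →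
  count p + count q + count r + count s ≡ sum f
count-cover p q r s f cover = begin
  count p + count q + count r + count s
    ≡⟨ cong₂ _+_ (cong₂ _+_ (cong₂ _+_ (count-as-sum p) (count-as-sum q)) (count-as-sum r))
                 (count-as-sum s) ⟩
  sum ι[ p ] + sum ι[ q ] + sum ι[ r ] + sum ι[ s ]
    ≡⟨ cong (λ x → x + sum ι[ r ] + sum ι[ s ]) (∑-distrib-+ ι[ p ] ι[ q ]) ⟨
  sum (λ v → ι[ p ] v + ι[ q ] v) + sum ι[ r ] + sum ι[ s ]
    ≡⟨ cong (_+ sum ι[ s ]) (∑-distrib-+ (λ v → ι[ p ] v + ι[ q ] v) ι[ r ]) ⟨
  sum (λ v → ι[ p ] v + ι[ q ] v + ι[ r ] v) + sum ι[ s ]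
    ≡⟨ ∑-distrib-+ (λ v → ι[ p ] v + ι[ q ] v + ι[ r ] v) ι[ s ] ⟨
  sum (λ v → ι[ p ] v + ι[ q ] v + ι[ r ] v + ι[ s ] v)
    ≡⟨ sum-cong-≗ cover ⟩
  sum f ∎
  where
  open ≡-Reasoning
  ι[_] : ∀ {n} → (Fin n → Bool) → Fin n → ℕ
  ι[ p ] = indicator ∘ p

record Enumeration {n} (p : Fin n → Bool) (k : ℕ) : Set where
  field
    enum      : Fin k → Fin n
    injective : Injective _≡_ _≡_ enum
    image     : ∀ v → T (p v) ⇔ (∃[ i ] enum i ≡ v)

  index : ∀ {v} → T (p v) → Fin k
  index {v} pv = proj₁ (to (image v) pv)

  enum-index : ∀ {v} (pv : T (p v)) → enum (index pv) ≡ v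
  enum-index {v} pv = proj₂ (to (image v) pv)

  enum-satisfies : ∀ i → T (p (enum i))
  enum-satisfies i = from (image (enum i)) (i , refl)

  index-enum : ∀ {i v} (pv : T (p v)) → enum i ≡ v → index pv ≡ i
  index-enum pv ei≡v = injective (trans (enum-index pv) (sym ei≡v))

open Enumeration

enumerate-sum : ∀ {n} (p : Fin n → Bool) → Enumeration p (sum (indicator ∘ p))
enumerate-sum {zero}  p = record { enum = λ (); injective = λ {}; image = λ () }
enumerate-sum {suc n} p with p zero in p₀
... | true = record { enum = e ; injective = e-injective ; image = e-image }
  where
  E : Enumeration (p ∘ suc) (sum (indicator ∘ p ∘ suc))
  E = enumerate-sum (p ∘ suc)
  e : Fin (suc _) → Fin (suc n)
  e zero    = zero
  e (suc i) = suc (enum E i)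
  e-injective : Injective _≡_ _≡_ e
  e-injective {zero}  {zero}  _  = refl
  e-injective {zero}  {suc _} ()
  e-injective {suc _} {zero}  ()
  e-injective {suc i} {suc j} eq = cong suc (injective E (suc-injective eq))
  e-image : ∀ v → T (p v) ⇔ (∃[ i ] e i ≡ v)
  e-image zero    = mk⇔ (λ _ → zero , refl) (λ _ → subst T (sym p₀) tt)
  e-image (suc v) = mk⇔ (λ pv → let (i , eq) = to (image E v) pv in suc i , cong suc eq)
    λ { (zero , ()) ; (suc i , eq) → from (image E v) (i , suc-injective eq) }
... | false = record { enum = suc ∘ enum E ; injective = injective E ∘ suc-injective ; image = e-image }
  where
  E : Enumeration (p ∘ suc) (sum (indicator ∘ p ∘ suc))
  E = enumerate-sum (p ∘ suc)
  e-image : ∀ v → T (p v) ⇔ (∃[ i ] suc (enum E i) ≡ v)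
  e-image zero    = mk⇔ (λ pv → ⊥-elim (subst T p₀ pv)) λ ()
  e-image (suc v) = mk⇔ (λ pv → let (i , eq) = to (image E v) pv in i , cong suc eq)
    λ (i , eq) → from (image E v) (i , suc-injective eq)

enumerate : ∀ {n} (p : Fin n → Bool) → Enumeration p (count p)
enumerate p = subst (Enumeration p) (sym (count-as-sum p)) (enumerate-sum p)

enumeration-≤ : ∀ {n} {p : Fin n → Bool} {k m} → Enumeration p k → Enumeration p m → k ≤ m
enumeration-≤ E F = injective⇒≤ f-injective
  where
  f : Fin _ → Fin _
  f i = index F (enum-satisfies E i)
  f-injective : Injective _≡_ _≡_ f
  f-injective {i} {j} eq = injective E (begin
    enum E i              ≡⟨ enum-index F (enum-satisfies E i) ⟨
    enum F (f i)          ≡⟨ cong (enum F) eq ⟩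
    enum F (f j)          ≡⟨ enum-index F (enum-satisfies E j) ⟩
    enum E j              ∎)
    where open ≡-Reasoning

enumeration-size : ∀ {n} {p : Fin n → Bool} {k} → Enumeration p k → k ≡ count p
enumeration-size {p = p} E = ≤-antisym (enumeration-≤ E (enumerate p)) (enumeration-≤ (enumerate p) E)

map-enumeration : ∀ {m n k} {p : Fin m → Bool} {q : Fin n → Bool}
  (E : Enumeration p k) (f : Fin m → Fin n) →
  (∀ {u v} → T (p u) → T (p v) → f u ≡ f v → u ≡ v) →
  (∀ w → T (q w) ⇔ (∃[ v ] T (p v) × f v ≡ w)) →
  Enumeration q k
map-enumeration E f f-injective q-image = record
  { enum      = f ∘ enum E
  ; injective = λ {i} {j} eq → injective E (f-injective (enum-satisfies E i) (enum-satisfies E j) eq)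
  ; image     = λ w → mk⇔
      (λ qw → let (v , pv , fv≡w) = to (q-image w) qw
              in index E pv , trans (cong f (enum-index E pv)) fv≡w)
      (λ (i , eq) → from (q-image w) (enum E i , enum-satisfies E i , eq))
  }

from-does : ∀ {A : Set} (a? : Dec A) → T (does a?) → A
from-does (yes a) _ = a

to-does : ∀ {A : Set} (a? : Dec A) → A → T (does a?)
to-does (yes _) _ = tt
to-does (no ¬a) a = ¬a a

adj-sym : ∀ {n} (G : Graph n) {u v} → Adj G u v → Adj G v u
adj-sym G {u} {v} uv = trans (symm G v u) uv

adj⇒≢ : ∀ {n} (G : Graph n) {u v} → Adj G u v → u ≢ v
adj⇒≢ G {u} uv refl with trans (sym uv) (irrefl G u)
... | ()

count-≤-clique-number : ∀ {n m} (G : Graph n) {ω} →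
  (∀ k (f : Fin k → Fin n) → IsClique G f → k ≤ ω) →
  (p : Fin m → Bool) (f : Fin m → Fin n) → Injective _≡_ _≡_ f →
  (∀ {i j} → T (p i) → T (p j) → i ≢ j → Adj G (f i) (f j)) → count p ≤ ω
count-≤-clique-number G ω-max p f f-injective f-adjacent =
  ω-max _ (f ∘ enum E) (f∘e-injective , f∘e-adjacent)
  where
  E : Enumeration p (count p)
  E = enumerate p
  f∘e-injective : Injective _≡_ _≡_ (f ∘ enum E)
  f∘e-injective = injective E ∘ f-injective
  f∘e-adjacent : ∀ i j → i ≢ j → Adj G (f (enum E i)) (f (enum E j))
  f∘e-adjacent i j i≢j = f-adjacent (enum-satisfies E i) (enum-satisfies E j) (i≢j ∘ injective E)

other : Fin 2 → Fin 2
other 0F = 1F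
other 1F = 0F

≢⇒other : ∀ {s t : Fin 2} → t ≢ s → t ≡ other s
≢⇒other {0F} {0F} t≢s = ⊥-elim (t≢s refl)
≢⇒other {0F} {1F} _   = refl
≢⇒other {1F} {0F} _   = refl
≢⇒other {1F} {1F} t≢s = ⊥-elim (t≢s refl)

other-≢ : ∀ s → other s ≢ s
other-≢ 0F ()
other-≢ 1F ()

other-involutive : ∀ s → other (other s) ≡ s
other-involutive 0F = refl
other-involutive 1F = refl

-- A vertex's part is determined by its side (0F is X), whether its colour class also meets
-- the other side, and whether it is the chosen b-vertex of its colour.
code : Part → Fin 2 × Bool × Bool
code A₁ = 0F , false , true
code B₁ = 0F , true  , false
code C₁ = 0F , true  , true
code A₂ = 1F , false , true
code B₂ = 1F , true  , true
code C₂ = 1F , true  , false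

label : Fin 2 × Bool × Bool → Part
label (0F , false , _)     = A₁
label (0F , true  , false) = B₁
label (0F , true  , true)  = C₁
label (1F , false , _)     = A₂
label (1F , true  , true)  = B₂
label (1F , true  , false) = C₂

label-code : ∀ P → label (code P) ≡ P
label-code A₁ = refl
label-code B₁ = refl
label-code C₁ = refl
label-code A₂ = refl
label-code B₂ = refl
label-code C₂ = refl

code-label : ∀ s p r → (p ≡ false → r ≡ true) → code (label (s , p , r)) ≡ (s , p , r)
code-label 0F false false unpaired⇒r with () ← unpaired⇒r refl
code-label 0F false true  _ = refl
code-label 0F true  false _ = refl
code-label 0F true  true  _ = refl
code-label 1F false false unpaired⇒r with () ← unpaired⇒r refl
code-label 1F false true  _ = refl
code-label 1F true  false _ = refl
code-label 1F true  true  _ = refl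

atX : Fin 2 → Bool
atX 0F = true
atX 1F = false

atX-injective : ∀ {s t} → atX s ≡ atX t → s ≡ t
atX-injective {0F} {0F} _ = refl
atX-injective {1F} {1F} _ = refl
atX-injective {0F} {1F} ()
atX-injective {1F} {0F} ()

inX-label : ∀ s p r → inX (label (s , p , r)) ≡ atX s
inX-label 0F false _     = refl
inX-label 0F true  false = refl
inX-label 0F true  true  = refl
inX-label 1F false _     = refl
inX-label 1F true  true  = refl
inX-label 1F true  false = refl

label-cover : ∀ s p r → (p ≡ false → r ≡ true) →
  indicator (isA₁ (label (s , p , r))) + indicator (isA₂ (label (s , p , r)))
    + indicator (isB₂ (label (s , p , r))) + indicator (isC₁ (label (s , p , r))) ≡ indicator r
label-cover 0F false false unpaired⇒r with () ← unpaired⇒r refl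
label-cover 0F false true  _ = refl
label-cover 0F true  false _ = refl
label-cover 0F true  true  _ = refl
label-cover 1F false false unpaired⇒r with () ← unpaired⇒r refl
label-cover 1F false true  _ = refl
label-cover 1F true  false _ = refl
label-cover 1F true  true  _ = refl

T-isA₁ : ∀ p → T (isA₁ p) ⇔ p ≡ A₁
T-isA₁ p = mk⇔ (sound p) λ { refl → tt }
  where sound : ∀ p → T (isA₁ p) → p ≡ A₁
        sound A₁ _ = refl

T-isA₂ : ∀ p → T (isA₂ p) ⇔ p ≡ A₂
T-isA₂ p = mk⇔ (sound p) λ { refl → tt }
  where sound : ∀ p → T (isA₂ p) → p ≡ A₂
        sound A₂ _ = refl

T-isB₁ : ∀ p → T (isB₁ p) ⇔ p ≡ B₁
T-isB₁ p = mk⇔ (sound p) λ { refl → tt }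
  where sound : ∀ p → T (isB₁ p) → p ≡ B₁
        sound B₁ _ = refl

T-isB₂ : ∀ p → T (isB₂ p) ⇔ p ≡ B₂
T-isB₂ p = mk⇔ (sound p) λ { refl → tt }
  where sound : ∀ p → T (isB₂ p) → p ≡ B₂
        sound B₂ _ = refl

T-isC₁ : ∀ p → T (isC₁ p) ⇔ p ≡ C₁
T-isC₁ p = mk⇔ (sound p) λ { refl → tt }
  where sound : ∀ p → T (isC₁ p) → p ≡ C₁
        sound C₁ _ = refl

T-isC₂ : ∀ p → T (isC₂ p) ⇔ p ≡ C₂
T-isC₂ p = mk⇔ (sound p) λ { refl → tt }
  where sound : ∀ p → T (isC₂ p) → p ≡ C₂
        sound C₂ _ = refl

-- b-colourings of co-bipartite graphs

module CoBipartite {n} (G : Graph n) (side : Fin n → Fin 2)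
  (side-proper : ∀ u v → Adj (complement G) u v → side u ≢ side v) where

  same-side⇒adjacent : ∀ {u v} → u ≢ v → side u ≡ side v → Adj G u v
  same-side⇒adjacent {u} {v} u≢v same with adj G u v in uv
  ... | true  = refl
  ... | false = ⊥-elim (side-proper u v non-adjacent same)
    where
    non-adjacent : Adj (complement G) u v
    non-adjacent with u ≟ v
    ... | yes u≡v = ⊥-elim (u≢v u≡v)
    ... | no _    = cong not′ uv

  module BColouring {b} (c : Fin n → Fin b) (c-b : IsBColoring G b c) where

    proper : ∀ {u v} → Adj G u v → c u ≢ c v
    proper = proj₁ c-b _ _

    unique-on-side : ∀ {u v} → c u ≡ c v → side u ≡ side v → u ≡ v
    unique-on-side {u} {v} same-colour same-side with u ≟ v
    ... | yes u≡v = u≡v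
    ... | no  u≢v = ⊥-elim (proper (same-side⇒adjacent u≢v same-side) same-colour)

    bvertex : Fin b → Fin n
    bvertex i = proj₁ (proj₂ (proj₂ c-b) i)

    bvertex-colour : ∀ i → c (bvertex i) ≡ i
    bvertex-colour i = proj₁ (proj₂ (proj₂ (proj₂ c-b) i))

    bvertex-neighbour : ∀ i j → j ≢ i → ∃[ w ] Adj G (bvertex i) w × c w ≡ j
    bvertex-neighbour i = proj₂ (proj₂ (proj₂ (proj₂ c-b) i))

    OccursOn : Fin 2 → Fin b → Set
    OccursOn s i = ∃[ v ] c v ≡ i × side v ≡ s

    occursOn? : ∀ s i → Dec (OccursOn s i)
    occursOn? s i = any? λ v → (c v ≟ i) ×-dec (side v ≟ s)

    vertexOn : Fin 2 → Fin b → Fin n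
    vertexOn s i with occursOn? s i
    ... | yes (v , _) = v
    ... | no  _       = bvertex i

    vertexOn-colour : ∀ s i → c (vertexOn s i) ≡ i
    vertexOn-colour s i with occursOn? s i
    ... | yes (_ , cv≡i , _) = cv≡i
    ... | no  _              = bvertex-colour i

    vertexOn-side : ∀ {s i} → OccursOn s i → side (vertexOn s i) ≡ s
    vertexOn-side {s} {i} occurs with occursOn? s i
    ... | yes (_ , _ , on-s) = on-s
    ... | no  absent         = ⊥-elim (absent occurs)

    colour-section-injective : ∀ {f : Fin b → Fin n} → (∀ i → c (f i) ≡ i) →
      Injective _≡_ _≡_ f
    colour-section-injective {f} cf {i} {j} eq = trans (sym (cf i)) (trans (cong c eq) (cf j))

    single-sided-adjacent : ∀ {s i j} → ¬ OccursOn s j → i ≢ j → Adj G (bvertex i) (bvertex j)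
    single-sided-adjacent {s} {i} {j} absent i≢j =
      let (w , adjacent , cw≡j) = bvertex-neighbour i j (i≢j ∘ sym)
      in subst (Adj G (bvertex i)) (unique-on-side (trans cw≡j (sym (bvertex-colour j)))
           (trans (off-side cw≡j) (sym (off-side (bvertex-colour j))))) adjacent
      where
      off-side : ∀ {v} → c v ≡ j → side v ≡ other s
      off-side {v} cv≡j = ≢⇒other (λ on-s → absent (v , cv≡j , on-s))

    InBClique : Fin 2 → Fin b → Set
    InBClique s i = side (bvertex i) ≡ s ⊎ ¬ OccursOn s i

    inBClique? : ∀ s i → Dec (InBClique s i)
    inBClique? s i = (side (bvertex i) ≟ s) ⊎-dec ¬? (occursOn? s i)

    inBClique onSide : Fin 2 → Fin b → Bool
    inBClique s i = does (inBClique? s i)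
    onSide s i = does (occursOn? s i)

    bClique-adjacent : ∀ {s i j} → InBClique s i → InBClique s j → i ≢ j →
      Adj G (bvertex i) (bvertex j)
    bClique-adjacent (inj₁ on-s) (inj₁ on-s′) i≢j =
      same-side⇒adjacent (i≢j ∘ colour-section-injective bvertex-colour) (trans on-s (sym on-s′))
    bClique-adjacent _ (inj₂ absent) i≢j = single-sided-adjacent absent i≢j
    bClique-adjacent (inj₂ absent) _ i≢j = adj-sym G (single-sided-adjacent absent (i≢j ∘ sym))

    onSide-adjacent : ∀ {s i j} → OccursOn s i → OccursOn s j → i ≢ j →
      Adj G (vertexOn s i) (vertexOn s j)
    onSide-adjacent occurs occurs′ i≢j =
      same-side⇒adjacent (i≢j ∘ colour-section-injective (vertexOn-colour _))
        (trans (vertexOn-side occurs) (sym (vertexOn-side occurs′)))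

    cliques-per-side : ∀ s i →
      indicator (inBClique s i) + indicator (onSide s i) ≡ 1 + indicator (does (side (bvertex i) ≟ s))
    cliques-per-side s i = go (side (bvertex i) ≟ s) (occursOn? s i)
      where
      go : (on-s : Dec (side (bvertex i) ≡ s)) (occurs : Dec (OccursOn s i)) →
        indicator (does on-s ∨ not (does occurs)) + indicator (does occurs) ≡ 1 + indicator (does on-s)
      go (yes _)    (yes _)     = refl
      go (yes on-s) (no absent) = ⊥-elim (absent (bvertex i , bvertex-colour i , on-s))
      go (no _)     (yes _)     = refl
      go (no _)     (no _)      = refl

    cliques-per-colour : ∀ i →
      indicator (inBClique 0F i) + indicator (onSide 0F i)
        + indicator (inBClique 1F i) + indicator (onSide 1F i) ≡ 3
    cliques-per-colour i = begin
      k₀ + h₀ + k₁ + h₁       ≡⟨ +-assoc (k₀ + h₀) k₁ h₁ ⟩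
      k₀ + h₀ + (k₁ + h₁)     ≡⟨ cong₂ _+_ (cliques-per-side 0F i) (cliques-per-side 1F i) ⟩
      1 + indicator (does (side (bvertex i) ≟ 0F)) + (1 + indicator (does (side (bvertex i) ≟ 1F)))
                              ≡⟨ on-one-side (side (bvertex i)) ⟩
      3                       ∎
      where
      open ≡-Reasoning
      k₀ h₀ k₁ h₁ : ℕ
      k₀ = indicator (inBClique 0F i)
      h₀ = indicator (onSide 0F i)
      k₁ = indicator (inBClique 1F i)
      h₁ = indicator (onSide 1F i)
      on-one-side : ∀ t → 1 + indicator (does (t ≟ 0F)) + (1 + indicator (does (t ≟ 1F))) ≡ 3
      on-one-side 0F = refl
      on-one-side 1F = refl

    3b≤4ω : ∀ {ω} → (∀ k (f : Fin k → Fin n) → IsClique G f → k ≤ ω) → 3 * b ≤ 4 * ω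
    3b≤4ω {ω} ω-max = begin
      3 * b                    ≡⟨ *-comm 3 b ⟩
      b * 3                    ≡⟨ sum-const b 3 ⟨
      sum {b} (λ _ → 3)        ≡⟨ count-cover (inBClique 0F) (onSide 0F) (inBClique 1F) (onSide 1F) _
                                                cliques-per-colour ⟨
      count (inBClique 0F) + count (onSide 0F) + count (inBClique 1F) + count (onSide 1F)
                               ≤⟨ +-mono-≤ (+-mono-≤ (+-mono-≤ (bClique-≤ 0F) (onSide-≤ 0F))
                                                     (bClique-≤ 1F)) (onSide-≤ 1F) ⟩
      ω + ω + ω + ω            ≡⟨ four-times ω ⟩
      4 * ω                    ∎
      where
      open ≤-Reasoning
      bClique-≤ : ∀ s → count (inBClique s) ≤ ω
      bClique-≤ s = count-≤-clique-number G ω-max _ bvertex (colour-section-injective bvertex-colour)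
        λ {i} {j} i∈ j∈ →
          bClique-adjacent (from-does (inBClique? s i) i∈) (from-does (inBClique? s j) j∈)
      onSide-≤ : ∀ s → count (onSide s) ≤ ω
      onSide-≤ s =
        count-≤-clique-number G ω-max _ (vertexOn s) (colour-section-injective (vertexOn-colour s))
          λ {i} {j} i∈ j∈ →
            onSide-adjacent (from-does (occursOn? s i) i∈) (from-does (occursOn? s j) j∈)

    Paired : Fin n → Set
    Paired v = OccursOn (other (side v)) (c v)

    paired : Fin n → Bool
    paired v = does (occursOn? (other (side v)) (c v))

    isBVertex : Fin n → Bool
    isBVertex v = does (bvertex (c v) ≟ v)

    unpaired⇒bvertex : ∀ {v} → ¬ Paired v → bvertex (c v) ≡ v
    unpaired⇒bvertex {v} unpaired = unique-on-side (bvertex-colour (c v)) same-side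
      where
      same-side : side (bvertex (c v)) ≡ side v
      same-side with side (bvertex (c v)) ≟ side v
      ... | yes same = same
      ... | no  differ = ⊥-elim (unpaired (bvertex (c v) , bvertex-colour (c v) , ≢⇒other differ))

    partner : Fin n → Fin n
    partner v = vertexOn (other (side v)) (c v)

    partner-colour : ∀ v → c (partner v) ≡ c v
    partner-colour v = vertexOn-colour _ _

    module _ {v} (v-paired : Paired v) where

      partner-side : side (partner v) ≡ other (side v)
      partner-side = vertexOn-side v-paired

      partner-≢ : partner v ≢ v
      partner-≢ eq = other-≢ (side v) (trans (sym partner-side) (cong side eq))

      partner-paired : Paired (partner v)
      partner-paired = v , sym (partner-colour v) ,
        sym (trans (cong other partner-side) (other-involutive (side v)))

      partner-involutive : partner (partner v) ≡ v
      partner-involutive = unique-on-side (trans (partner-colour _) (partner-colour v))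
        (trans (vertexOn-side partner-paired) (trans (cong other partner-side) (other-involutive (side v))))

      bvertex-of-pair : bvertex (c v) ≡ v ⊎ bvertex (c v) ≡ partner v
      bvertex-of-pair with side (bvertex (c v)) ≟ side v
      ... | yes same   = inj₁ (unique-on-side (bvertex-colour (c v)) same)
      ... | no  differ = inj₂ (unique-on-side (trans (bvertex-colour (c v)) (sym (partner-colour v)))
                                             (trans (≢⇒other differ) (sym partner-side)))

      isBVertex-partner : isBVertex (partner v) ≡ not (isBVertex v)
      isBVertex-partner rewrite partner-colour v with bvertex-of-pair
      ... | inj₁ b≡v  = trans (dec-false (_ ≟ partner v) (λ b≡pv → partner-≢ (trans (sym b≡pv) b≡v)))
                              (cong not (sym (dec-true (_ ≟ v) b≡v)))
      ... | inj₂ b≡pv = trans (dec-true (_ ≟ partner v) b≡pv)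
                              (cong not (sym (dec-false (_ ≟ v) (partner-≢ ∘ trans (sym b≡pv)))))

    partner-injective : ∀ {u v} → Paired u → Paired v → partner u ≡ partner v → u ≡ v
    partner-injective u-paired v-paired eq =
      trans (sym (partner-involutive u-paired)) (trans (cong partner eq) (partner-involutive v-paired))

    triple : Fin n → Fin 2 × Bool × Bool
    triple v = side v , paired v , isBVertex v

    lab : Fin n → Part
    lab v = label (triple v)

    paired-of : ∀ {v s r} → triple v ≡ (s , true , r) → Paired v
    paired-of {v} eq = from-does (occursOn? _ _) (subst T (sym (cong (proj₁ ∘ proj₂) eq)) tt)

    unpaired-of : ∀ {v s r} → triple v ≡ (s , false , r) → ¬ Paired v
    unpaired-of {v} eq v-paired
      with () ← trans (sym (dec-true (occursOn? _ _) v-paired)) (cong (proj₁ ∘ proj₂) eq)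

    bvertex-of : ∀ {v s p} → triple v ≡ (s , p , true) → bvertex (c v) ≡ v
    bvertex-of {v} eq = from-does (_ ≟ v) (subst T (sym (cong (proj₂ ∘ proj₂) eq)) tt)

    unpaired⇒isBVertex : ∀ v → paired v ≡ false → isBVertex v ≡ true
    unpaired⇒isBVertex v eq = dec-true (_ ≟ v)
      (unpaired⇒bvertex (unpaired-of {r = isBVertex v} (cong (λ p → side v , p , isBVertex v) eq)))

    code-lab : ∀ v → code (lab v) ≡ triple v
    code-lab v = code-label (side v) (paired v) (isBVertex v) (unpaired⇒isBVertex v)

    lab≡⇔ : ∀ {v P} → lab v ≡ P ⇔ triple v ≡ code P
    lab≡⇔ {v} {P} = mk⇔ (λ eq → trans (sym (code-lab v)) (cong code eq))
                         (λ eq → trans (cong label eq) (label-code P))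

    across : Fin 2 × Bool × Bool → Fin 2 × Bool × Bool
    across (s , _ , r) = other s , true , not r

    triple-partner : ∀ {v} → Paired v → triple (partner v) ≡ across (triple v)
    triple-partner v-paired = cong₂ _,_ (partner-side v-paired)
      (cong₂ _,_ (dec-true (occursOn? _ _) (partner-paired v-paired)) (isBVertex-partner v-paired))

    partner-image : ∀ {s r} w →
      triple w ≡ across (s , true , r) ⇔ (∃[ v ] triple v ≡ (s , true , r) × partner v ≡ w)
    partner-image {s} {r} w = mk⇔
      (λ eq → partner w , trans (triple-partner (paired-of eq)) (trans (cong across eq) across-across)
                        , partner-involutive (paired-of eq))
      (λ (v , eq , pv≡w) →
         trans (cong triple (sym pv≡w)) (trans (triple-partner (paired-of eq)) (cong across eq)))
      where
      across-across : across (across (s , true , r)) ≡ (s , true , r)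
      across-across = cong₂ _,_ (other-involutive s) (cong (true ,_) (not-involutive r))

    partner-antimatching : ∀ {s r} (P Q : Fin n → Bool) →
      (∀ w → T (P w) ⇔ triple w ≡ (s , true , r)) →
      (∀ w → T (Q w) ⇔ triple w ≡ across (s , true , r)) →
      count P ≡ count Q × PerfectAntimatching G Q P
    partner-antimatching P Q P⇔ Q⇔ = enumeration-size EQ ,
      (count P , enum EQ , enum EP , injective EQ , injective EP , image EQ , image EP ,
       λ i adjacent → proper adjacent (partner-colour (enum EP i)))
      where
      EP : Enumeration P (count P)
      EP = enumerate P
      EQ : Enumeration Q (count P)
      EQ = map-enumeration EP partner
        (λ {u} {v} Pu Pv → partner-injective (paired-of (to (P⇔ u) Pu)) (paired-of (to (P⇔ v) Pv)))
        (λ w → mk⇔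
          (λ Qw → let (v , eq , pv≡w) = to (partner-image w) (to (Q⇔ w) Qw)
                  in v , from (P⇔ v) eq , pv≡w)
          (λ (v , Pv , pv≡w) → from (Q⇔ w) (from (partner-image w) (v , to (P⇔ v) Pv , pv≡w))))

    lab-is : ∀ {is : Part → Bool} {P} → (∀ p → T (is p) ⇔ p ≡ P) →
      ∀ w → T (is (lab w)) ⇔ triple w ≡ code P
    lab-is T-is w = lab≡⇔ ⇔-∘ T-is (lab w)

    B-antimatching : count (isB₂ ∘ lab) ≡ count (isB₁ ∘ lab) ×
                     PerfectAntimatching G (isB₁ ∘ lab) (isB₂ ∘ lab)
    B-antimatching = partner-antimatching _ _ (lab-is T-isB₂) (lab-is T-isB₁)

    C-antimatching : count (isC₂ ∘ lab) ≡ count (isC₁ ∘ lab) ×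
                     PerfectAntimatching G (isC₁ ∘ lab) (isC₂ ∘ lab)
    C-antimatching = partner-antimatching _ _ (lab-is T-isC₂) (lab-is T-isC₁)

    bvertex-enumeration : Enumeration isBVertex b
    bvertex-enumeration = record
      { enum      = bvertex
      ; injective = colour-section-injective bvertex-colour
      ; image     = λ v → mk⇔ (λ t → c v , from-does (_ ≟ v) t)
          λ (i , bi≡v) → to-does (_ ≟ v)
            (trans (cong bvertex (trans (cong c (sym bi≡v)) (bvertex-colour i))) bi≡v)
      }

    b≡count : b ≡ count (isA₁ ∘ lab) + count (isA₂ ∘ lab) + count (isB₁ ∘ lab) + count (isC₁ ∘ lab)
    b≡count = begin
      b                                                    ≡⟨ enumeration-size bvertex-enumeration ⟩
      count isBVertex                                      ≡⟨ count-as-sum isBVertex ⟩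
      sum (indicator ∘ isBVertex)                          ≡⟨ count-cover _ _ _ _ _ per-vertex ⟨
      count (isA₁ ∘ lab) + count (isA₂ ∘ lab) + count (isB₂ ∘ lab) + count (isC₁ ∘ lab)
        ≡⟨ cong (λ k → count (isA₁ ∘ lab) + count (isA₂ ∘ lab) + k + count (isC₁ ∘ lab))
                (proj₁ B-antimatching) ⟩
      count (isA₁ ∘ lab) + count (isA₂ ∘ lab) + count (isB₁ ∘ lab) + count (isC₁ ∘ lab) ∎
      where
      open ≡-Reasoning
      per-vertex : ∀ v → indicator (isA₁ (lab v)) + indicator (isA₂ (lab v))
                           + indicator (isB₂ (lab v)) + indicator (isC₁ (lab v)) ≡ indicator (isBVertex v)
      per-vertex v = label-cover (side v) (paired v) (isBVertex v) (unpaired⇒isBVertex v)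

    same-X⇒adjacent : ∀ u v → u ≢ v → inX (lab u) ≡ inX (lab v) → Adj G u v
    same-X⇒adjacent u v u≢v same = same-side⇒adjacent u≢v
      (atX-injective (trans (sym (inX-label (side u) _ _)) (trans same (inX-label (side v) _ _))))

    adjacent-to-unpaired : ∀ {u v s t p} → triple u ≡ (s , p , true) → triple v ≡ (t , false , true) →
      u ≢ v → Adj G u v
    adjacent-to-unpaired {u} {v} u-triple v-triple u≢v =
      subst₂ (Adj G) (bvertex-of u-triple) (bvertex-of v-triple)
        (single-sided-adjacent (unpaired-of v-triple) λ cu≡cv →
          u≢v (trans (sym (bvertex-of u-triple)) (trans (cong bvertex cu≡cv) (bvertex-of v-triple))))

    lab-≢ : ∀ {u v P Q} → lab u ≡ P → lab v ≡ Q → P ≢ Q → u ≢ v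
    lab-≢ lu lv P≢Q refl = P≢Q (trans (sym lu) lv)

    A₁-adjacent : ∀ u v → lab u ≡ A₁ → lab v ≡ A₂ ⊎ lab v ≡ B₂ → Adj G u v
    A₁-adjacent u v lu (inj₁ lv) =
      adjacent-to-unpaired (to lab≡⇔ lu) (to lab≡⇔ lv) (lab-≢ lu lv λ ())
    A₁-adjacent u v lu (inj₂ lv) =
      adj-sym G (adjacent-to-unpaired (to lab≡⇔ lv) (to lab≡⇔ lu) (lab-≢ lv lu λ ()))

    A₂-adjacent : ∀ u v → lab u ≡ A₂ → lab v ≡ C₁ → Adj G u v
    A₂-adjacent u v lu lv =
      adj-sym G (adjacent-to-unpaired (to lab≡⇔ lv) (to lab≡⇔ lu) (lab-≢ lv lu λ ()))

    inFamilyA : InFamilyA G b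
    inFamilyA = (side , side-proper) , lab , same-X⇒adjacent , A₁-adjacent , A₂-adjacent ,
      proj₂ B-antimatching , proj₂ C-antimatching , b≡count

-- From a member of 𝒜_b to a b-colouring

IsBColouringBy : ∀ {n} {C : Set} → Graph n → (Fin n → C) → Set
IsBColouringBy G c =
  (∀ u v → Adj G u v → c u ≢ c v) ×
  (∀ i → ∃[ v ] c v ≡ i) ×
  (∀ i → ∃[ v ] (c v ≡ i × (∀ j → j ≢ i → ∃[ w ] (Adj G v w × c w ≡ j))))

recolour : ∀ {n b} {C : Set} {G : Graph n} {c : Fin n → C} →
  Fin b ↔ C → IsBColouringBy G c → HasBColoring G b
recolour {c = c} e (proper , surjective , bvertices) = from′ ∘ c ,
  (λ u v adjacent eq → proper u v adjacent (from-injective eq)) ,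
  (λ i → let (v , cv≡) = surjective (to′ i) in v , from-to cv≡) ,
  λ i → let (v , cv≡ , neighbours) = bvertices (to′ i) in v , from-to cv≡ ,
    λ j j≢i → let (w , adjacent , cw≡) = neighbours (to′ j) (j≢i ∘ to-injective)
              in w , adjacent , from-to cw≡
  where
  open Inverse e renaming (to to to′; from to from′)
  from-to : ∀ {x i} → x ≡ to′ i → from′ x ≡ i
  from-to {i = i} refl = strictlyInverseʳ i
  from-injective : ∀ {x y} → from′ x ≡ from′ y → x ≡ y
  from-injective {x} {y} eq = trans (sym (strictlyInverseˡ x)) (trans (cong to′ eq) (strictlyInverseˡ y))
  to-injective : ∀ {i j} → to′ i ≡ to′ j → i ≡ j
  to-injective {i} {j} eq = trans (sym (strictlyInverseʳ i)) (trans (cong from′ eq) (strictlyInverseʳ j))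

module FromFamily {n} (G : Graph n) (lab : Fin n → Part)
  (X-clique : ∀ u v → u ≢ v → inX (lab u) ≡ inX (lab v) → Adj G u v)
  (A₁-adjacent : ∀ u v → lab u ≡ A₁ → lab v ≡ A₂ ⊎ lab v ≡ B₂ → Adj G u v)
  (A₂-adjacent : ∀ u v → lab u ≡ A₂ → lab v ≡ C₁ → Adj G u v)
  {kB} (SB : Enumeration (isB₁ ∘ lab) kB) (TB : Enumeration (isB₂ ∘ lab) kB)
  (B-non-adjacent : ∀ i → ¬ Adj G (enum SB i) (enum TB i))
  {kC} (SC : Enumeration (isC₁ ∘ lab) kC) (TC : Enumeration (isC₂ ∘ lab) kC)
  (C-non-adjacent : ∀ i → ¬ Adj G (enum SC i) (enum TC i))
  where

  EA₁ : Enumeration (isA₁ ∘ lab) (count (isA₁ ∘ lab))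
  EA₁ = enumerate (isA₁ ∘ lab)

  EA₂ : Enumeration (isA₂ ∘ lab) (count (isA₂ ∘ lab))
  EA₂ = enumerate (isA₂ ∘ lab)

  Colour : Set
  Colour = ((Fin (count (isA₁ ∘ lab)) ⊎ Fin (count (isA₂ ∘ lab))) ⊎ Fin kB) ⊎ Fin kC

  pattern colA₁ i = inj₁ (inj₁ (inj₁ i))
  pattern colA₂ i = inj₁ (inj₁ (inj₂ i))
  pattern colB i  = inj₁ (inj₂ i)
  pattern colC i  = inj₂ i

  fin↔colour : Fin (count (isA₁ ∘ lab) + count (isA₂ ∘ lab) + kB + kC) ↔ Colour
  fin↔colour = ((+↔⊎ ⊎-↔ ↔-id _) ⊎-↔ ↔-id _) ↔-∘ ((+↔⊎ ⊎-↔ ↔-id _) ↔-∘ +↔⊎)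

  Member : Colour → Fin n → Set
  Member (colA₁ i) v = enum EA₁ i ≡ v
  Member (colA₂ i) v = enum EA₂ i ≡ v
  Member (colB i)  v = enum SB i ≡ v ⊎ enum TB i ≡ v
  Member (colC i)  v = enum SC i ≡ v ⊎ enum TC i ≡ v

  -- The equation lab v ≡ P is an argument so that lemmas about colour can case on P.
  colourAt : ∀ v P → lab v ≡ P → Colour
  colourAt v A₁ eq = colA₁ (index EA₁ (from (T-isA₁ _) eq))
  colourAt v A₂ eq = colA₂ (index EA₂ (from (T-isA₂ _) eq))
  colourAt v B₁ eq = colB  (index SB (from (T-isB₁ _) eq))
  colourAt v B₂ eq = colB  (index TB (from (T-isB₂ _) eq))
  colourAt v C₁ eq = colC  (index SC (from (T-isC₁ _) eq))
  colourAt v C₂ eq = colC  (index TC (from (T-isC₂ _) eq))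

  colour : Fin n → Colour
  colour v = colourAt v (lab v) refl

  colour≡colourAt : ∀ v P (eq : lab v ≡ P) → colour v ≡ colourAt v P eq
  colour≡colourAt v _ refl = refl

  colourAt-member : ∀ v P (eq : lab v ≡ P) → Member (colourAt v P eq) v
  colourAt-member v A₁ eq = enum-index EA₁ (from (T-isA₁ _) eq)
  colourAt-member v A₂ eq = enum-index EA₂ (from (T-isA₂ _) eq)
  colourAt-member v B₁ eq = inj₁ (enum-index SB (from (T-isB₁ _) eq))
  colourAt-member v B₂ eq = inj₂ (enum-index TB (from (T-isB₂ _) eq))
  colourAt-member v C₁ eq = inj₁ (enum-index SC (from (T-isC₁ _) eq))
  colourAt-member v C₂ eq = inj₂ (enum-index TC (from (T-isC₂ _) eq))

  colour-member : ∀ v → Member (colour v) v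
  colour-member v = colourAt-member v (lab v) refl

  lab-enum : ∀ {is : Part → Bool} {P k} (E : Enumeration (is ∘ lab) k) → (∀ p → T (is p) ⇔ p ≡ P) →
    ∀ i → lab (enum E i) ≡ P
  lab-enum E T-is i = to (T-is _) (enum-satisfies E i)

  member-colour : ∀ col v → Member col v → colour v ≡ col
  member-colour (colA₁ i) v refl =
    trans (colour≡colourAt v A₁ (lab-enum EA₁ T-isA₁ i)) (cong colA₁ (index-enum EA₁ _ refl))
  member-colour (colA₂ i) v refl =
    trans (colour≡colourAt v A₂ (lab-enum EA₂ T-isA₂ i)) (cong colA₂ (index-enum EA₂ _ refl))
  member-colour (colB i) v (inj₁ refl) =
    trans (colour≡colourAt v B₁ (lab-enum SB T-isB₁ i)) (cong colB (index-enum SB _ refl))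
  member-colour (colB i) v (inj₂ refl) =
    trans (colour≡colourAt v B₂ (lab-enum TB T-isB₂ i)) (cong colB (index-enum TB _ refl))
  member-colour (colC i) v (inj₁ refl) =
    trans (colour≡colourAt v C₁ (lab-enum SC T-isC₁ i)) (cong colC (index-enum SC _ refl))
  member-colour (colC i) v (inj₂ refl) =
    trans (colour≡colourAt v C₂ (lab-enum TC T-isC₂ i)) (cong colC (index-enum TC _ refl))

  member-independent : ∀ col {u v} → Member col u → Member col v → ¬ Adj G u v
  member-independent (colA₁ _) refl refl uv = adj⇒≢ G uv refl
  member-independent (colA₂ _) refl refl uv = adj⇒≢ G uv refl
  member-independent (colB _) (inj₁ refl) (inj₁ refl) uv = adj⇒≢ G uv refl
  member-independent (colB _) (inj₂ refl) (inj₂ refl) uv = adj⇒≢ G uv refl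
  member-independent (colB i) (inj₁ refl) (inj₂ refl) uv = B-non-adjacent i uv
  member-independent (colB i) (inj₂ refl) (inj₁ refl) uv = B-non-adjacent i (adj-sym G uv)
  member-independent (colC _) (inj₁ refl) (inj₁ refl) uv = adj⇒≢ G uv refl
  member-independent (colC _) (inj₂ refl) (inj₂ refl) uv = adj⇒≢ G uv refl
  member-independent (colC i) (inj₁ refl) (inj₂ refl) uv = C-non-adjacent i uv
  member-independent (colC i) (inj₂ refl) (inj₁ refl) uv = C-non-adjacent i (adj-sym G uv)

  bvertex : Colour → Fin n
  bvertex (colA₁ i) = enum EA₁ i
  bvertex (colA₂ i) = enum EA₂ i
  bvertex (colB i)  = enum TB i
  bvertex (colC i)  = enum SC i

  bvertex-member : ∀ col → Member col (bvertex col)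
  bvertex-member (colA₁ _) = refl
  bvertex-member (colA₂ _) = refl
  bvertex-member (colB _)  = inj₂ refl
  bvertex-member (colC _)  = inj₁ refl

  memberX memberY : Colour → Fin n
  memberX (colA₁ i) = enum EA₁ i
  memberX (colA₂ i) = enum EA₂ i
  memberX (colB i)  = enum SB i
  memberX (colC i)  = enum SC i
  memberY (colA₁ i) = enum EA₁ i
  memberY (colA₂ i) = enum EA₂ i
  memberY (colB i)  = enum TB i
  memberY (colC i)  = enum TC i

  neighbour : Colour → Colour → Fin n
  neighbour (colA₁ _) = memberX
  neighbour (colA₂ _) = memberY
  neighbour (colB _)  = memberY
  neighbour (colC _)  = memberX

  memberX-member : ∀ col → Member col (memberX col)
  memberX-member (colA₁ _) = refl
  memberX-member (colA₂ _) = refl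
  memberX-member (colB _)  = inj₁ refl
  memberX-member (colC _)  = inj₁ refl

  memberY-member : ∀ col → Member col (memberY col)
  memberY-member (colA₁ _) = refl
  memberY-member (colA₂ _) = refl
  memberY-member (colB _)  = inj₂ refl
  memberY-member (colC _)  = inj₂ refl

  neighbour-member : ∀ col col′ → Member col′ (neighbour col col′)
  neighbour-member (colA₁ _) = memberX-member
  neighbour-member (colA₂ _) = memberY-member
  neighbour-member (colB _)  = memberY-member
  neighbour-member (colC _)  = memberX-member

  bvertex-adjacent : ∀ col col′ → col′ ≢ col → Adj G (bvertex col) (neighbour col col′)
  bvertex-adjacent col col′ col′≢col = go col col′ distinct
    where
    distinct : bvertex col ≢ neighbour col col′
    distinct eq = col′≢col (trans (sym (member-colour col′ _ (neighbour-member col col′)))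
      (trans (cong colour (sym eq)) (member-colour col _ (bvertex-member col))))
    same-side : ∀ {u v P Q} → lab u ≡ P → lab v ≡ Q → inX P ≡ inX Q → u ≢ v → Adj G u v
    same-side lu lv same u≢v = X-clique _ _ u≢v (trans (cong inX lu) (trans same (cong inX (sym lv))))
    ℓA₁ : ∀ i → lab (enum EA₁ i) ≡ A₁
    ℓA₁ = lab-enum EA₁ T-isA₁
    ℓA₂ : ∀ i → lab (enum EA₂ i) ≡ A₂
    ℓA₂ = lab-enum EA₂ T-isA₂
    ℓSB : ∀ i → lab (enum SB i) ≡ B₁
    ℓSB = lab-enum SB T-isB₁
    ℓTB : ∀ i → lab (enum TB i) ≡ B₂
    ℓTB = lab-enum TB T-isB₂
    ℓSC : ∀ i → lab (enum SC i) ≡ C₁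
    ℓSC = lab-enum SC T-isC₁
    ℓTC : ∀ i → lab (enum TC i) ≡ C₂
    ℓTC = lab-enum TC T-isC₂
    go : ∀ col col′ → bvertex col ≢ neighbour col col′ → Adj G (bvertex col) (neighbour col col′)
    go (colA₁ i) (colA₁ j)   = same-side (ℓA₁ i) (ℓA₁ j) refl
    go (colA₁ i) (colA₂ j) _ = A₁-adjacent _ _ (ℓA₁ i) (inj₁ (ℓA₂ j))
    go (colA₁ i) (colB j)    = same-side (ℓA₁ i) (ℓSB j) refl
    go (colA₁ i) (colC j)    = same-side (ℓA₁ i) (ℓSC j) refl
    go (colA₂ i) (colA₁ j) _ = adj-sym G (A₁-adjacent _ _ (ℓA₁ j) (inj₁ (ℓA₂ i)))
    go (colA₂ i) (colA₂ j)   = same-side (ℓA₂ i) (ℓA₂ j) refl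
    go (colA₂ i) (colB j)    = same-side (ℓA₂ i) (ℓTB j) refl
    go (colA₂ i) (colC j)    = same-side (ℓA₂ i) (ℓTC j) refl
    go (colB i)  (colA₁ j) _ = adj-sym G (A₁-adjacent _ _ (ℓA₁ j) (inj₂ (ℓTB i)))
    go (colB i)  (colA₂ j)   = same-side (ℓTB i) (ℓA₂ j) refl
    go (colB i)  (colB j)    = same-side (ℓTB i) (ℓTB j) refl
    go (colB i)  (colC j)    = same-side (ℓTB i) (ℓTC j) refl
    go (colC i)  (colA₁ j)   = same-side (ℓSC i) (ℓA₁ j) refl
    go (colC i)  (colA₂ j) _ = adj-sym G (A₂-adjacent _ _ (ℓA₂ j) (ℓSC i))
    go (colC i)  (colB j)    = same-side (ℓSC i) (ℓSB j) refl
    go (colC i)  (colC j)    = same-side (ℓSC i) (ℓSC j) refl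

  isBColouring : IsBColouringBy G colour
  isBColouring =
    (λ u v uv eq → member-independent (colour v)
                     (subst (λ col → Member col u) eq (colour-member u)) (colour-member v) uv) ,
    (λ col → bvertex col , member-colour col _ (bvertex-member col)) ,
    λ col → bvertex col , member-colour col _ (bvertex-member col) , λ col′ col′≢col →
      neighbour col col′ , bvertex-adjacent col col′ col′≢col ,
      member-colour col′ _ (neighbour-member col col′)

  hasBColouring : HasBColoring G (count (isA₁ ∘ lab) + count (isA₂ ∘ lab) + kB + kC)
  hasBColouring = recolour {G = G} fin↔colour isBColouring

family⇒bColouring : ∀ {n b} {G : Graph n} → InFamilyA G b → HasBColoring G b
family⇒bColouring {b = b} {G = G} (_ , lab , X-clique , A₁-adjacent , A₂-adjacent ,
    (kB , sB , tB , sB-injective , tB-injective , sB-image , tB-image , B-non-adjacent) ,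
    (kC , sC , tC , sC-injective , tC-injective , sC-image , tC-image , C-non-adjacent) , b≡)
  = subst (HasBColoring G) (sym b≡colours)
      (FromFamily.hasBColouring G lab X-clique A₁-adjacent A₂-adjacent
                                SB TB B-non-adjacent SC TC C-non-adjacent)
  where
  SB : Enumeration (isB₁ ∘ lab) kB
  SB = record { enum = sB ; injective = sB-injective ; image = sB-image }
  TB : Enumeration (isB₂ ∘ lab) kB
  TB = record { enum = tB ; injective = tB-injective ; image = tB-image }
  SC : Enumeration (isC₁ ∘ lab) kC
  SC = record { enum = sC ; injective = sC-injective ; image = sC-image }
  TC : Enumeration (isC₂ ∘ lab) kC
  TC = record { enum = tC ; injective = tC-injective ; image = tC-image }
  b≡colours : b ≡ count (isA₁ ∘ lab) + count (isA₂ ∘ lab) + kB + kC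
  b≡colours = trans b≡ (cong₂ (λ x y → count (isA₁ ∘ lab) + count (isA₂ ∘ lab) + x + y)
                              (sym (enumeration-size SB)) (sym (enumeration-size SC)))

theorem3 : ∀ {n} (G : Graph n) → IsCoBipartite G →
    (∀ ω φ → IsCliqueNumber G ω → IsBChromaticNumber G φ → 3 * φ ≤ 4 * ω) ×
    (∀ (b : ℕ) → NonZero b → (HasBColoring G b ⇔ InFamilyA G b))
theorem3 G (side , side-proper) =
  (λ ω φ (_ , ω-max) ((c , c-b) , _) → BColouring.3b≤4ω c c-b ω-max) ,
  λ b _ → mk⇔ (λ (c , c-b) → BColouring.inFamilyA c c-b) family⇒bColouring
  where open CoBipartite G side side-proper
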